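{- Let $P$ be a bounded and graded poset. Then $G_P(t)=G_{P^*}(t)$.
   Context: All posets are finite, bounded (least element $\widehat 0$, greatest element $\widehat 1$) and graded with rank function $\rho$, $\rho(\widehat 0)=0$. The dual $P^*$ has the same elements with $x\le^* y$ iff $y\le x$ in $P$. Chow polynomial: with $\mu$ the Möbius function, $\chi_{[x,y]}(t)=\sum_{x\le z\le y}\mu(x,z)t^{\rho(y)-\rho(z)}$; $\overline{\chi}_{[x,x]}=-1$ and $\overline{\chi}_{[x,y]}=\chi_{[x,y]}/(t-1)$ for $x<y$; $\underline{H}_{[x,x]}=1$ and $\underline{H}_{[x,y]}=\sum_{x<z\le y}\overline{\chi}_{[x,z]}\underline{H}_{[z,y]}$ for $x<y$. The augmented Chow polynomial of $Q$ is $G_Q(t):=\sum_{z\in Q}t^{\rho(z)}\underline{H}_{[z,\widehat1]}(t)$. -}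

module Defs where

open import Data.Nat using (ℕ; zero; suc; _∸_; _≤_)
open import Data.Integer as ℤ using (ℤ; +_; -_)
open import Data.Fin using (Fin; _≟_)
open import Data.List using (List; foldr; filterᵇ)
open import Data.Vec.Functional using ()
open import Data.Fin.Base using ()
open import Data.List.Base using (allFin)
open import Data.Bool using (Bool; true; false; _∧_; not; if_then_else_)
open import Data.Product using (_×_)
open import Data.Sum using (_⊎_)
open import Relation.Nullary using (¬_; does)
open import Relation.Binary.PropositionalEquality using (_≡_)
import Data.Nat as ℕ

-- Polynomials in ℤ[t] embed into ℤ[[t]]; t - 1 is invertible in ℤ[[t]],
-- so division by (t - 1) is computed there (it agrees with exact
-- polynomial division whenever the latter exists).

PS : Set
PS = ℕ → ℤ

0ₚ : PS
0ₚ _ = + 0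

tpow : ℕ → PS
tpow i j = if does (i ℕ.≟ j) then + 1 else + 0

1ₚ : PS
1ₚ = tpow 0

_+ₚ_ : PS → PS → PS
(p +ₚ q) k = p k ℤ.+ q k

scaleₚ : ℤ → PS → PS
scaleₚ a p k = a ℤ.* p k

sumUpTo : (ℕ → ℤ) → ℕ → ℤ
sumUpTo f zero = f 0
sumUpTo f (suc k) = sumUpTo f k ℤ.+ f (suc k)

_*ₚ_ : PS → PS → PS
(p *ₚ q) k = sumUpTo (λ i → p i ℤ.* q (k ∸ i)) k

div-t-1 : PS → PS
div-t-1 p k = - sumUpTo p k

record RawGradedPoset : Set where
  field
    n   : ℕ
    le  : Fin n → Fin n → Bool
    bot : Fin n
    top : Fin n
    ρ   : Fin n → ℕ

module _ (P : RawGradedPoset) where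
  open RawGradedPoset P

  Le : Fin n → Fin n → Set
  Le x y = le x y ≡ true

  Covers : Fin n → Fin n → Set
  Covers x y = Le x y × (¬ x ≡ y) ×
               (∀ z → Le x z → Le z y → (z ≡ x) ⊎ (z ≡ y))

  record IsBoundedGraded : Set where
    field
      refl    : ∀ x → Le x x
      antisym : ∀ x y → Le x y → Le y x → x ≡ y
      trans   : ∀ x y z → Le x y → Le y z → Le x z
      bot-min : ∀ x → Le bot x
      top-max : ∀ x → Le x top
      ρ-bot   : ρ bot ≡ 0
      ρ-cover : ∀ x y → Covers x y → ρ y ≡ suc (ρ x)

record BoundedGradedPoset : Set where
  field
    raw       : RawGradedPoset
    isBounded : IsBoundedGraded raw
  open RawGradedPoset raw public

dual : RawGradedPoset → RawGradedPoset
dual P = record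
  { n = n ; le = λ x y → le y x ; bot = top ; top = bot
  ; ρ = λ x → ρ top ∸ ρ x }
  where open RawGradedPoset P

module Chow (P : RawGradedPoset) where
  open RawGradedPoset P

  eqᵇ : Fin n → Fin n → Bool
  eqᵇ x y = does (x ≟ y)

  ltᵇ : Fin n → Fin n → Bool
  ltᵇ x y = le x y ∧ not (eqᵇ x y)

  Σℤ : (Fin n → Bool) → (Fin n → ℤ) → ℤ
  Σℤ b f = foldr (λ z acc → f z ℤ.+ acc) (+ 0) (filterᵇ b (allFin n))

  Σₚ : (Fin n → Bool) → (Fin n → PS) → PS
  Σₚ b f k = Σℤ b (λ z → f z k)

  -- Möbius function, by recursion with fuel (fuel n suffices since
  -- every chain of P has at most n elements):
  -- μ(x,x) = 1, μ(x,y) = - Σ_{x ≤ z < y} μ(x,z) for x < y, 0 otherwise.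
  μ-fuel : ℕ → Fin n → Fin n → ℤ
  μ-fuel zero x y = + 0
  μ-fuel (suc f) x y =
    if eqᵇ x y then + 1
    else if le x y then - Σℤ (λ z → le x z ∧ ltᵇ z y) (λ z → μ-fuel f x z)
    else + 0

  μ : Fin n → Fin n → ℤ
  μ = μ-fuel n

  χ : Fin n → Fin n → PS
  χ x y = Σₚ (λ z → le x z ∧ le z y) (λ z → scaleₚ (μ x z) (tpow (ρ y ∸ ρ z)))

  χ̄ : Fin n → Fin n → PS
  χ̄ x y = if eqᵇ x y then scaleₚ (- + 1) 1ₚ else div-t-1 (χ x y)

  H-fuel : ℕ → Fin n → Fin n → PS
  H-fuel zero x y = 0ₚ
  H-fuel (suc f) x y =
    if eqᵇ x y then 1ₚ
    else Σₚ (λ z → ltᵇ x z ∧ le z y) (λ z → χ̄ x z *ₚ H-fuel f z y)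

  H̲ : Fin n → Fin n → PS
  H̲ = H-fuel n

  G : PS
  G = Σₚ (λ _ → true) (λ z → tpow (ρ z) *ₚ H̲ z top)

-- Work with P-indexed matrices over ℤ[[t]]. Let μ be the Möbius matrix and ζₜ(x,y) = t^(ρ y - ρ x)
-- for x ≤ y, so that χ = μ ζₜ. As (t-1) χ̄ = χ - t and the recursion defining H̲ says χ̄ H̲ = -1,
-- we get (t - μ ζₜ) H̲ = t - 1. The Möbius matrix and ζₜ of P* are the transposes of those of P
-- (for ζₜ because ρ is monotone), so the same identity for P*, transposed, reads K (t - ζₜ μ) = t - 1
-- with K(x,y) = H̲_{P*}(y,x). Since (t - ζₜ μ) ζₜ = ζₜ (t - μ ζₜ), this gives (t-1) K ζₜ = (t-1) ζₜ H̲,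
-- and t - 1 cancels in ℤ[[t]]. The (0̂,1̂) entries of ζₜ H̲ and K ζₜ are G_P and G_{P*}.

module Submission where

open import Defs
open import Data.Nat using (ℕ)
open import Relation.Binary.PropositionalEquality using (_≡_; module ≡-Reasoning)

module PowerSeries where

  open import Algebra.Bundles using (CommutativeRing)
  import Algebra.Construct.Pointwise as Pointwise
  import Algebra.Properties.CommutativeSemigroup as CommSemigroupProperties
  open import Data.Integer as ℤ using (ℤ; +_; -_)
  import Data.Integer.Properties as ℤ
  open import Data.Integer.Tactic.RingSolver using (solve-∀)
  open import Data.Nat as ℕ using (zero; suc; _∸_; _≤_; z≤n)
  import Data.Nat.Properties as ℕ
  open import Data.Product using (_,_)
  open import Level using (0ℓ)
  open import Relation.Binary.PropositionalEquality using (refl; sym; trans; cong; cong₂)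

  open CommSemigroupProperties ℤ.+-commutativeSemigroup using (interchange)
  open import Algebra.Properties.AbelianGroup ℤ.+-0-abelianGroup using (∙-cancelˡ)

  infix 4 _≈ₚ_
  _≈ₚ_ : PS → PS → Set
  p ≈ₚ q = ∀ k → p k ≡ q k

  -ₚ_ : PS → PS
  (-ₚ p) k = - p k

  sumUpTo-cong : ∀ {f g : ℕ → ℤ} k → (∀ i → i ≤ k → f i ≡ g i) → sumUpTo f k ≡ sumUpTo g k
  sumUpTo-cong zero    f≗g = f≗g 0 z≤n
  sumUpTo-cong (suc k) f≗g =
    cong₂ ℤ._+_ (sumUpTo-cong k (λ i i≤k → f≗g i (ℕ.m≤n⇒m≤1+n i≤k))) (f≗g (suc k) ℕ.≤-refl)

  sumUpTo-zero : ∀ (f : ℕ → ℤ) k → (∀ i → i ≤ k → f i ≡ + 0) → sumUpTo f k ≡ + 0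
  sumUpTo-zero f zero    f≗0 = f≗0 0 z≤n
  sumUpTo-zero f (suc k) f≗0 =
    cong₂ ℤ._+_ (sumUpTo-zero f k (λ i i≤k → f≗0 i (ℕ.m≤n⇒m≤1+n i≤k))) (f≗0 (suc k) ℕ.≤-refl)

  sumUpTo-+ : ∀ (f g : ℕ → ℤ) k → sumUpTo (λ i → f i ℤ.+ g i) k ≡ sumUpTo f k ℤ.+ sumUpTo g k
  sumUpTo-+ f g zero    = refl
  sumUpTo-+ f g (suc k) = trans (cong (ℤ._+ (f (suc k) ℤ.+ g (suc k))) (sumUpTo-+ f g k))
                                (interchange (sumUpTo f k) (sumUpTo g k) (f (suc k)) (g (suc k)))

  *-distribˡ-sumUpTo : ∀ c (f : ℕ → ℤ) k → c ℤ.* sumUpTo f k ≡ sumUpTo (λ i → c ℤ.* f i) k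
  *-distribˡ-sumUpTo c f zero    = refl
  *-distribˡ-sumUpTo c f (suc k) =
    trans (ℤ.*-distribˡ-+ c (sumUpTo f k) (f (suc k))) (cong (ℤ._+ c ℤ.* f (suc k)) (*-distribˡ-sumUpTo c f k))

  *-distribʳ-sumUpTo : ∀ c (f : ℕ → ℤ) k → sumUpTo f k ℤ.* c ≡ sumUpTo (λ i → f i ℤ.* c) k
  *-distribʳ-sumUpTo c f k = trans (ℤ.*-comm (sumUpTo f k) c)
    (trans (*-distribˡ-sumUpTo c f k) (sumUpTo-cong k (λ i _ → ℤ.*-comm c (f i))))

  sumUpTo-headTail : ∀ (f : ℕ → ℤ) k → sumUpTo f (suc k) ≡ f 0 ℤ.+ sumUpTo (λ i → f (suc i)) k
  sumUpTo-headTail f zero    = refl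
  sumUpTo-headTail f (suc k) =
    trans (cong (ℤ._+ f (suc (suc k))) (sumUpTo-headTail f k)) (ℤ.+-assoc (f 0) _ _)

  sumUpTo-reverse : ∀ (f : ℕ → ℤ) k → sumUpTo f k ≡ sumUpTo (λ i → f (k ∸ i)) k
  sumUpTo-reverse f zero    = refl
  sumUpTo-reverse f (suc k) = begin
    sumUpTo f k ℤ.+ f (suc k)                   ≡⟨ cong (ℤ._+ f (suc k)) (sumUpTo-reverse f k) ⟩
    sumUpTo (λ i → f (k ∸ i)) k ℤ.+ f (suc k)   ≡⟨ ℤ.+-comm _ (f (suc k)) ⟩
    f (suc k) ℤ.+ sumUpTo (λ i → f (k ∸ i)) k   ≡⟨ sumUpTo-headTail (λ i → f (suc k ∸ i)) k ⟨
    sumUpTo (λ i → f (suc k ∸ i)) (suc k)       ∎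
    where open ≡-Reasoning

  sumUpTo-triangle : ∀ (f : ℕ → ℕ → ℤ) k →
    sumUpTo (λ i → sumUpTo (λ j → f j i) i) k ≡ sumUpTo (λ j → sumUpTo (λ l → f j (j ℕ.+ l)) (k ∸ j)) k
  sumUpTo-triangle f zero    = refl
  sumUpTo-triangle f (suc k) = begin
    sumUpTo (λ i → sumUpTo (λ j → f j i) i) k ℤ.+ (column k ℤ.+ f (suc k) (suc k))
      ≡⟨ cong (ℤ._+ (column k ℤ.+ f (suc k) (suc k))) (sumUpTo-triangle f k) ⟩
    rows k k ℤ.+ (column k ℤ.+ f (suc k) (suc k))
      ≡⟨ ℤ.+-assoc (rows k k) (column k) _ ⟨
    (rows k k ℤ.+ column k) ℤ.+ f (suc k) (suc k)
      ≡⟨ cong (ℤ._+ f (suc k) (suc k)) (sumUpTo-+ (row k) (λ j → f j (suc k)) k) ⟨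
    sumUpTo (λ j → row k j ℤ.+ f j (suc k)) k ℤ.+ f (suc k) (suc k)
      ≡⟨ cong₂ ℤ._+_ (sumUpTo-cong k extendRow) (cong (f (suc k)) (sym (ℕ.+-identityʳ (suc k)))) ⟩
    rows (suc k) k ℤ.+ f (suc k) (suc k ℕ.+ 0)
      ≡⟨ cong (λ m → rows (suc k) k ℤ.+ sumUpTo (λ l → f (suc k) (suc k ℕ.+ l)) m) (ℕ.n∸n≡0 k) ⟨
    rows (suc k) (suc k) ∎
    where
    open ≡-Reasoning
    row : ℕ → ℕ → ℤ
    row k j = sumUpTo (λ l → f j (j ℕ.+ l)) (k ∸ j)
    rows : ℕ → ℕ → ℤ
    rows k m = sumUpTo (row k) m
    column : ℕ → ℤ
    column k = sumUpTo (λ j → f j (suc k)) k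
    extendRow : ∀ j → j ≤ k → row k j ℤ.+ f j (suc k) ≡ row (suc k) j
    extendRow j j≤k rewrite ℕ.+-∸-assoc 1 j≤k =
      cong (λ m → row k j ℤ.+ f j m)
        (trans (sym (ℕ.m+[n∸m]≡n (ℕ.m≤n⇒m≤1+n j≤k))) (cong (j ℕ.+_) (ℕ.+-∸-assoc 1 j≤k)))

  *ₚ-cong : ∀ {p p′ q q′} → p ≈ₚ p′ → q ≈ₚ q′ → (p *ₚ q) ≈ₚ (p′ *ₚ q′)
  *ₚ-cong p≈p′ q≈q′ k = sumUpTo-cong k (λ i _ → cong₂ ℤ._*_ (p≈p′ i) (q≈q′ (k ∸ i)))

  *ₚ-congˡ : ∀ p {q q′} → q ≈ₚ q′ → (p *ₚ q) ≈ₚ (p *ₚ q′)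
  *ₚ-congˡ p = *ₚ-cong {p} (λ _ → refl)

  *ₚ-congʳ : ∀ q {p p′} → p ≈ₚ p′ → (p *ₚ q) ≈ₚ (p′ *ₚ q)
  *ₚ-congʳ q p≈p′ = *ₚ-cong {q = q} p≈p′ (λ _ → refl)

  *ₚ-comm : ∀ p q → (p *ₚ q) ≈ₚ (q *ₚ p)
  *ₚ-comm p q k = trans (sumUpTo-reverse (λ i → p i ℤ.* q (k ∸ i)) k)
    (sumUpTo-cong k (λ i i≤k →
      trans (cong (λ m → p (k ∸ i) ℤ.* q m) (ℕ.m∸[m∸n]≡n i≤k)) (ℤ.*-comm (p (k ∸ i)) (q i))))

  *ₚ-assoc : ∀ p q r → ((p *ₚ q) *ₚ r) ≈ₚ (p *ₚ (q *ₚ r))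
  *ₚ-assoc p q r k = begin
    sumUpTo (λ i → sumUpTo (λ j → p j ℤ.* q (i ∸ j)) i ℤ.* r (k ∸ i)) k
      ≡⟨ sumUpTo-cong k (λ i _ → *-distribʳ-sumUpTo (r (k ∸ i)) (λ j → p j ℤ.* q (i ∸ j)) i) ⟩
    sumUpTo (λ i → sumUpTo (λ j → p j ℤ.* q (i ∸ j) ℤ.* r (k ∸ i)) i) k
      ≡⟨ sumUpTo-triangle (λ j i → p j ℤ.* q (i ∸ j) ℤ.* r (k ∸ i)) k ⟩
    sumUpTo (λ j → sumUpTo (λ l → p j ℤ.* q (j ℕ.+ l ∸ j) ℤ.* r (k ∸ (j ℕ.+ l))) (k ∸ j)) k
      ≡⟨ sumUpTo-cong k (λ j _ → sumUpTo-cong (k ∸ j) (λ l _ →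
           trans (cong₂ (λ a b → p j ℤ.* q a ℤ.* r b) (ℕ.m+n∸m≡n j l) (sym (ℕ.∸-+-assoc k j l)))
                 (ℤ.*-assoc (p j) (q l) (r (k ∸ j ∸ l))))) ⟩
    sumUpTo (λ j → sumUpTo (λ l → p j ℤ.* (q l ℤ.* r (k ∸ j ∸ l))) (k ∸ j)) k
      ≡⟨ sumUpTo-cong k (λ j _ → *-distribˡ-sumUpTo (p j) (λ l → q l ℤ.* r (k ∸ j ∸ l)) (k ∸ j)) ⟨
    sumUpTo (λ j → p j ℤ.* sumUpTo (λ l → q l ℤ.* r (k ∸ j ∸ l)) (k ∸ j)) k ∎
    where open ≡-Reasoning

  *ₚ-identityˡ : ∀ p → (1ₚ *ₚ p) ≈ₚ p
  *ₚ-identityˡ p zero    = ℤ.*-identityˡ (p 0)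
  *ₚ-identityˡ p (suc k) = begin
    sumUpTo (λ i → 1ₚ i ℤ.* p (suc k ∸ i)) (suc k)
      ≡⟨ sumUpTo-headTail (λ i → 1ₚ i ℤ.* p (suc k ∸ i)) k ⟩
    + 1 ℤ.* p (suc k) ℤ.+ sumUpTo (λ i → + 0 ℤ.* p (k ∸ i)) k
      ≡⟨ cong₂ ℤ._+_ (ℤ.*-identityˡ (p (suc k))) (sumUpTo-zero _ k (λ i _ → ℤ.*-zeroˡ (p (k ∸ i)))) ⟩
    p (suc k) ℤ.+ + 0
      ≡⟨ ℤ.+-identityʳ (p (suc k)) ⟩
    p (suc k) ∎
    where open ≡-Reasoning

  *ₚ-distribˡ-+ₚ : ∀ p q r → (p *ₚ (q +ₚ r)) ≈ₚ ((p *ₚ q) +ₚ (p *ₚ r))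
  *ₚ-distribˡ-+ₚ p q r k =
    trans (sumUpTo-cong k (λ i _ → ℤ.*-distribˡ-+ (p i) (q (k ∸ i)) (r (k ∸ i))))
          (sumUpTo-+ (λ i → p i ℤ.* q (k ∸ i)) (λ i → p i ℤ.* r (k ∸ i)) k)

  powerSeriesRing : CommutativeRing 0ℓ 0ℓ
  powerSeriesRing = record
    { Carrier = PS ; _≈_ = _≈ₚ_ ; _+_ = _+ₚ_ ; _*_ = _*ₚ_ ; -_ = -ₚ_ ; 0# = 0ₚ ; 1# = 1ₚ
    ; isCommutativeRing = record
      { isRing = record
        { +-isAbelianGroup = Pointwise.isAbelianGroup ℕ ℤ.+-0-isAbelianGroup
        ; *-cong = *ₚ-cong
        ; *-assoc = *ₚ-assoc
        ; *-identity = *ₚ-identityˡ , (λ p k → trans (*ₚ-comm p 1ₚ k) (*ₚ-identityˡ p k))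
        ; distrib = *ₚ-distribˡ-+ₚ , λ p q r k →
            trans (*ₚ-comm (q +ₚ r) p k)
                  (trans (*ₚ-distribˡ-+ₚ p q r k) (cong₂ ℤ._+_ (*ₚ-comm p q k) (*ₚ-comm p r k))) }
      ; *-comm = *ₚ-comm } }

  t-1 : PS
  t-1 = tpow 1 +ₚ (-ₚ 1ₚ)

  t-1*-coeff-zero : ∀ q → (t-1 *ₚ q) 0 ≡ - q 0
  t-1*-coeff-zero q = ℤ.-1*i≡-i (q 0)

  t-1*-coeff-suc : ∀ q k → (t-1 *ₚ q) (suc k) ≡ q k ℤ.- q (suc k)
  t-1*-coeff-suc q k = begin
    sumUpTo (λ i → t-1 i ℤ.* q (suc k ∸ i)) (suc k)
      ≡⟨ sumUpTo-headTail (λ i → t-1 i ℤ.* q (suc k ∸ i)) k ⟩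
    - + 1 ℤ.* q (suc k) ℤ.+ sumUpTo (λ i → t-1 (suc i) ℤ.* q (k ∸ i)) k
      ≡⟨ cong₂ ℤ._+_ (ℤ.-1*i≡-i (q (suc k))) (higherTerms k) ⟩
    - q (suc k) ℤ.+ q k
      ≡⟨ ℤ.+-comm (- q (suc k)) (q k) ⟩
    q k ℤ.- q (suc k) ∎
    where
    open ≡-Reasoning
    higherTerms : ∀ k → sumUpTo (λ i → t-1 (suc i) ℤ.* q (k ∸ i)) k ≡ q k
    higherTerms zero    = ℤ.*-identityˡ (q 0)
    higherTerms (suc k) = begin
      sumUpTo (λ i → t-1 (suc i) ℤ.* q (suc k ∸ i)) (suc k)
        ≡⟨ sumUpTo-headTail (λ i → t-1 (suc i) ℤ.* q (suc k ∸ i)) k ⟩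
      + 1 ℤ.* q (suc k) ℤ.+ sumUpTo (λ i → + 0 ℤ.* q (k ∸ i)) k
        ≡⟨ cong₂ ℤ._+_ (ℤ.*-identityˡ (q (suc k))) (sumUpTo-zero _ k (λ i _ → ℤ.*-zeroˡ (q (k ∸ i)))) ⟩
      q (suc k) ℤ.+ + 0
        ≡⟨ ℤ.+-identityʳ (q (suc k)) ⟩
      q (suc k) ∎

  t-1*div-t-1 : ∀ p → (t-1 *ₚ div-t-1 p) ≈ₚ p
  t-1*div-t-1 p zero    = trans (t-1*-coeff-zero (div-t-1 p)) (ℤ.neg-involutive (p 0))
  t-1*div-t-1 p (suc k) = trans (t-1*-coeff-suc (div-t-1 p) k)
    (telescope (sumUpTo p k) (p (suc k)))
    where
    telescope : ∀ a b → - a ℤ.- - (a ℤ.+ b) ≡ b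
    telescope = solve-∀

  t-1*-cancel : ∀ {p q} → (t-1 *ₚ p) ≈ₚ (t-1 *ₚ q) → p ≈ₚ q
  t-1*-cancel {p} {q} t-1p≈t-1q zero    = ℤ.neg-injective
    (trans (sym (t-1*-coeff-zero p)) (trans (t-1p≈t-1q 0) (t-1*-coeff-zero q)))
  t-1*-cancel {p} {q} t-1p≈t-1q (suc k) = ℤ.neg-injective (∙-cancelˡ (p k) _ _ (begin
    p k ℤ.- p (suc k)       ≡⟨ t-1*-coeff-suc p k ⟨
    (t-1 *ₚ p) (suc k)      ≡⟨ t-1p≈t-1q (suc k) ⟩
    (t-1 *ₚ q) (suc k)      ≡⟨ t-1*-coeff-suc q k ⟩
    q k ℤ.- q (suc k)       ≡⟨ cong (ℤ._- q (suc k)) (t-1*-cancel {p} {q} t-1p≈t-1q k) ⟨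
    p k ℤ.- q (suc k)       ∎))
    where open ≡-Reasoning

  constₚ : ℤ → PS
  constₚ a = scaleₚ a 1ₚ

  constₚ-*ₚ : ∀ a p → (constₚ a *ₚ p) ≈ₚ scaleₚ a p
  constₚ-*ₚ a p k = begin
    sumUpTo (λ i → a ℤ.* 1ₚ i ℤ.* p (k ∸ i)) k    ≡⟨ sumUpTo-cong k (λ i _ → ℤ.*-assoc a (1ₚ i) (p (k ∸ i))) ⟩
    sumUpTo (λ i → a ℤ.* (1ₚ i ℤ.* p (k ∸ i))) k  ≡⟨ *-distribˡ-sumUpTo a (λ i → 1ₚ i ℤ.* p (k ∸ i)) k ⟨
    a ℤ.* (1ₚ *ₚ p) k                             ≡⟨ cong (a ℤ.*_) (*ₚ-identityˡ p k) ⟩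
    a ℤ.* p k                                     ∎
    where open ≡-Reasoning

module Matrices where

  open import Algebra.Bundles using (CommutativeRing; Ring)
  import Algebra.Construct.Pointwise as Pointwise
  import Algebra.Properties.Semiring.Sum as SemiringSum
  open import Data.Bool using (Bool; true; false; if_then_else_)
  open import Data.Fin using (Fin; _≟_; punchIn)
  open import Data.Fin.Properties using (punchInᵢ≢i)
  open import Data.Nat using (suc)
  open import Data.Product using (_,_)
  open import Function using (_∘_)
  open import Relation.Binary.PropositionalEquality as ≡ using (_≢_)
  open import Relation.Nullary using (does; yes; no)
  open import Relation.Nullary.Decidable using (dec-true; dec-false)

  module RingLemmas {c ℓ} (R : Ring c ℓ) where
    open Ring R
    open import Algebra.Properties.Ring R
      using (-‿distribˡ-*; -‿distribʳ-*; -‿involutive; ⁻¹-anti-homo‿-; [y-z]x≈yx-zx; x[y-z]≈xy-xz)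
    open import Relation.Binary.Reasoning.Setoid setoid

    left-inverse≈right-inverse : ∀ a b c → a * b ≈ 1# → b * c ≈ 1# → a ≈ c
    left-inverse≈right-inverse a b c ab≈1 bc≈1 = begin
      a             ≈⟨ *-identityʳ a ⟨
      a * 1#        ≈⟨ *-congˡ bc≈1 ⟨
      a * (b * c)   ≈⟨ *-assoc a b c ⟨
      (a * b) * c   ≈⟨ *-congʳ ab≈1 ⟩
      1# * c        ≈⟨ *-identityˡ c ⟩
      c             ∎

    push-through : ∀ t z m → t * z ≈ z * t → (t - z * m) * z ≈ z * (t - m * z)
    push-through t z m tz≈zt = begin
      (t - z * m) * z          ≈⟨ [y-z]x≈yx-zx z t (z * m) ⟩
      t * z - (z * m) * z      ≈⟨ +-cong tz≈zt (-‿cong (*-assoc z m z)) ⟩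
      z * t - z * (m * z)      ≈⟨ x[y-z]≈xy-xz z t (m * z) ⟨
      z * (t - m * z)          ∎

    intertwine : ∀ b b′ z h k u → b′ * z ≈ z * b → b * h ≈ u → k * b′ ≈ u → (k * z) * u ≈ (u * z) * h
    intertwine b b′ z h k u b′z≈zb bh≈u kb′≈u = begin
      (k * z) * u              ≈⟨ *-congˡ bh≈u ⟨
      (k * z) * (b * h)        ≈⟨ *-assoc k z (b * h) ⟩
      k * (z * (b * h))        ≈⟨ *-congˡ (*-assoc z b h) ⟨
      k * ((z * b) * h)        ≈⟨ *-congˡ (*-congʳ b′z≈zb) ⟨
      k * ((b′ * z) * h)       ≈⟨ *-congˡ (*-assoc b′ z h) ⟩
      k * (b′ * (z * h))       ≈⟨ *-assoc k b′ (z * h) ⟨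
      (k * b′) * (z * h)       ≈⟨ *-congʳ kb′≈u ⟩
      u * (z * h)              ≈⟨ *-assoc u z h ⟨
      (u * z) * h              ∎

    negate-inverse : ∀ c h u x t → u * c ≈ x - t → c * h ≈ - 1# → (t - x) * h ≈ u
    negate-inverse c h u x t uc≈x-t ch≈-1 = begin
      (t - x) * h              ≈⟨ *-congʳ (⁻¹-anti-homo‿- x t) ⟨
      - (x - t) * h            ≈⟨ *-congʳ (-‿cong uc≈x-t) ⟨
      - (u * c) * h            ≈⟨ -‿distribˡ-* (u * c) h ⟨
      - ((u * c) * h)          ≈⟨ -‿cong (*-assoc u c h) ⟩
      - (u * (c * h))          ≈⟨ -‿cong (*-congˡ ch≈-1) ⟩
      - (u * - 1#)             ≈⟨ -‿cong (-‿distribʳ-* u 1#) ⟨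
      - - (u * 1#)             ≈⟨ -‿involutive (u * 1#) ⟩
      u * 1#                   ≈⟨ *-identityʳ u ⟩
      u                        ∎

  module Sums {c ℓ} (R : CommutativeRing c ℓ) where
    open CommutativeRing R
    open SemiringSum semiring using (sum; sum-cong-≋; sum-remove; sum-replicate-zero)
    open import Relation.Binary.Reasoning.Setoid setoid

    sum-zero : ∀ {m} {f : Fin m → Carrier} → (∀ z → f z ≈ 0#) → sum f ≈ 0#
    sum-zero {m} f≈0 = trans (sum-cong-≋ f≈0) (sum-replicate-zero m)

    sum-single : ∀ {m} (x : Fin m) {f : Fin m → Carrier} → (∀ z → z ≢ x → f z ≈ 0#) → sum f ≈ f x
    sum-single {suc m} x {f} vanish = begin
      sum f                                ≈⟨ sum-remove {i = x} f ⟩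
      f x + sum (λ j → f (punchIn x j))   ≈⟨ +-congˡ (sum-zero (λ j → vanish (punchIn x j) (punchInᵢ≢i x j))) ⟩
      f x + 0#                             ≈⟨ +-identityʳ (f x) ⟩
      f x                                  ∎

    sum-indicator : ∀ {m} (b : Fin m → Bool) {f g : Fin m → Carrier} →
      (∀ z → b z ≡ true → f z ≈ g z) → (∀ z → b z ≡ false → g z ≈ 0#) →
      sum (λ z → if b z then f z else 0#) ≈ sum g
    sum-indicator b {f} {g} on off = sum-cong-≋ pointwise
      where
      pointwise : ∀ z → (if b z then f z else 0#) ≈ g z
      pointwise z with b z in e
      ... | true  = on z e
      ... | false = sym (off z e)

  module SquareMatrices {c ℓ} (R : CommutativeRing c ℓ) (n : ℕ) where
    open CommutativeRing R
    open SemiringSum semiring using (sum; sum-cong-≋; ∑-comm; ∑-distrib-+; *-distribˡ-sum; *-distribʳ-sum)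
    open Sums R using (sum-single)
    open import Relation.Binary.Reasoning.Setoid setoid

    Matrix : Set c
    Matrix = Fin n → Fin n → Carrier

    infix 4 _≋_
    _≋_ : Matrix → Matrix → Set ℓ
    A ≋ B = ∀ x y → A x y ≈ B x y

    infixl 7 _⊗_
    _⊗_ : Matrix → Matrix → Matrix
    (A ⊗ B) x y = sum (λ z → A x z * B z y)

    diag : Carrier → Matrix
    diag a x y = if does (x ≟ y) then a else 0#

    infixl 6 _⊖_
    _⊖_ : Matrix → Matrix → Matrix
    (A ⊖ B) x y = A x y - B x y

    _ᵀ : Matrix → Matrix
    (A ᵀ) x y = A y x

    diag-on : ∀ a x → diag a x x ≡ a
    diag-on a x rewrite dec-true (x ≟ x) ≡.refl = ≡.refl

    diag-off : ∀ a {x y} → x ≢ y → diag a x y ≡ 0#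
    diag-off a {x} {y} x≢y rewrite dec-false (x ≟ y) x≢y = ≡.refl

    diag-⊗ : ∀ a A → diag a ⊗ A ≋ λ x y → a * A x y
    diag-⊗ a A x y = begin
      sum (λ z → diag a x z * A z y)   ≈⟨ sum-single x (λ z z≢x → trans (*-congʳ (reflexive (diag-off a (z≢x ∘ ≡.sym)))) (zeroˡ (A z y))) ⟩
      diag a x x * A x y              ≈⟨ *-congʳ (reflexive (diag-on a x)) ⟩
      a * A x y                        ∎

    ⊗-diag : ∀ a A → A ⊗ diag a ≋ λ x y → A x y * a
    ⊗-diag a A x y = begin
      sum (λ z → A x z * diag a z y)   ≈⟨ sum-single y (λ z z≢y → trans (*-congˡ (reflexive (diag-off a z≢y))) (zeroʳ (A x z))) ⟩
      A x y * diag a y y              ≈⟨ *-congˡ (reflexive (diag-on a y)) ⟩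
      A x y * a                        ∎

    ⊗-cong : ∀ {A A′ B B′} → A ≋ A′ → B ≋ B′ → A ⊗ B ≋ A′ ⊗ B′
    ⊗-cong A≋A′ B≋B′ x y = sum-cong-≋ (λ z → *-cong (A≋A′ x z) (B≋B′ z y))

    ⊗-assoc : ∀ A B C → (A ⊗ B) ⊗ C ≋ A ⊗ (B ⊗ C)
    ⊗-assoc A B C x y = begin
      sum (λ w → sum (λ z → A x z * B z w) * C w y)
        ≈⟨ sum-cong-≋ (λ w → *-distribʳ-sum (C w y) (λ z → A x z * B z w)) ⟩
      sum (λ w → sum (λ z → A x z * B z w * C w y))
        ≈⟨ ∑-comm (λ w z → A x z * B z w * C w y) ⟩
      sum (λ z → sum (λ w → A x z * B z w * C w y))
        ≈⟨ sum-cong-≋ (λ z → sum-cong-≋ (λ w → *-assoc (A x z) (B z w) (C w y))) ⟩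
      sum (λ z → sum (λ w → A x z * (B z w * C w y)))
        ≈⟨ sum-cong-≋ (λ z → *-distribˡ-sum (A x z) (λ w → B z w * C w y)) ⟨
      sum (λ z → A x z * sum (λ w → B z w * C w y)) ∎

    ⊗-distribˡ : ∀ A B C → A ⊗ (λ x y → B x y + C x y) ≋ λ x y → (A ⊗ B) x y + (A ⊗ C) x y
    ⊗-distribˡ A B C x y = trans (sum-cong-≋ (λ z → distribˡ (A x z) (B z y) (C z y)))
                                 (∑-distrib-+ (λ z → A x z * B z y) (λ z → A x z * C z y))

    ⊗-distribʳ : ∀ A B C → (λ x y → B x y + C x y) ⊗ A ≋ λ x y → (B ⊗ A) x y + (C ⊗ A) x y
    ⊗-distribʳ A B C x y = trans (sum-cong-≋ (λ z → distribʳ (A z y) (B x z) (C x z)))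
                                 (∑-distrib-+ (λ z → B x z * A z y) (λ z → C x z * A z y))

    matrixRing : Ring c ℓ
    matrixRing = record
      { Carrier = Matrix ; _≈_ = _≋_
      ; _+_ = λ A B x y → A x y + B x y ; _*_ = _⊗_ ; -_ = λ A x y → - A x y
      ; 0# = λ _ _ → 0# ; 1# = diag 1#
      ; isRing = record
        { +-isAbelianGroup = Pointwise.isAbelianGroup (Fin n) (Pointwise.isAbelianGroup (Fin n) +-isAbelianGroup)
        ; *-cong = ⊗-cong
        ; *-assoc = ⊗-assoc
        ; *-identity = (λ A x y → trans (diag-⊗ 1# A x y) (*-identityˡ (A x y)))
                     , (λ A x y → trans (⊗-diag 1# A x y) (*-identityʳ (A x y)))
        ; distrib = ⊗-distribˡ , ⊗-distribʳ } }

    ⊗-ᵀ : ∀ A B → (A ⊗ B) ᵀ ≋ B ᵀ ⊗ A ᵀ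
    ⊗-ᵀ A B x y = sum-cong-≋ (λ z → *-comm (A y z) (B z x))

    diag-ᵀ : ∀ a → diag a ᵀ ≋ diag a
    diag-ᵀ a x y with x ≟ y
    ... | yes ≡.refl = reflexive (diag-on a x)
    ... | no x≢y = reflexive (diag-off a (x≢y ∘ ≡.sym))

    diag-central : ∀ a A → diag a ⊗ A ≋ A ⊗ diag a
    diag-central a A x y = trans (diag-⊗ a A x y) (trans (*-comm a (A x y)) (sym (⊗-diag a A x y)))

    sum-split : ∀ y a {g h : Fin n → Carrier} → (∀ z → g z ≈ diag a z y + h z) → sum g ≈ a + sum h
    sum-split y a {g} {h} g≈a+h = begin
      sum g                                  ≈⟨ sum-cong-≋ g≈a+h ⟩
      sum (λ z → diag a z y + h z)           ≈⟨ ∑-distrib-+ (λ z → diag a z y) h ⟩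
      sum (λ z → diag a z y) + sum h         ≈⟨ +-congʳ (sum-single y (λ z z≢y → reflexive (diag-off a z≢y))) ⟩
      diag a y y + sum h                     ≈⟨ +-congʳ (reflexive (diag-on a y)) ⟩
      a + sum h                              ∎

module Filters where

  open PowerSeries
  open import Algebra.Bundles using (CommutativeRing)
  import Algebra.Properties.Semiring.Sum as SemiringSum
  open import Data.Bool using (Bool; true; false; if_then_else_)
  open import Data.Fin using (Fin)
  open import Data.Integer as ℤ using (ℤ; +_)
  import Data.Integer.Properties as ℤ
  open import Data.List using (List; []; _∷_; foldr; length; filterᵇ; tabulate; allFin)
  open import Data.List.Membership.Propositional using (_∈_)
  open import Data.List.Relation.Unary.Any using (here; there)
  open import Data.Nat using (zero; suc; _≤_; _<_; z≤n; s≤s)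
  import Data.Nat.Properties as ℕ
  open import Function using (id)
  open import Relation.Nullary using (contradiction)
  open import Relation.Binary.PropositionalEquality using (refl; sym; trans; cong; cong₂)

  module ℤ-sum = SemiringSum ℤ.+-*-semiring
  module PS-sum = SemiringSum (CommutativeRing.semiring powerSeriesRing)

  foldr-+ : ∀ {A : Set} → (A → ℤ) → List A → ℤ
  foldr-+ f = foldr (λ z acc → f z ℤ.+ acc) (+ 0)

  foldr-+-filterᵇ : ∀ {A : Set} (b : A → Bool) (f : A → ℤ) xs →
    foldr-+ f (filterᵇ b xs) ≡ foldr-+ (λ z → if b z then f z else + 0) xs
  foldr-+-filterᵇ b f []       = refl
  foldr-+-filterᵇ b f (x ∷ xs) with b x
  ... | true  = cong (λ s → f x ℤ.+ s) (foldr-+-filterᵇ b f xs)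
  ... | false = trans (foldr-+-filterᵇ b f xs) (sym (ℤ.+-identityˡ _))

  foldr-+-tabulate : ∀ {m} {A : Set} (f : A → ℤ) (h : Fin m → A) → foldr-+ f (tabulate h) ≡ ℤ-sum.sum (λ i → f (h i))
  foldr-+-tabulate {zero}  f h = refl
  foldr-+-tabulate {suc m} f h = cong (λ s → f (h Fin.zero) ℤ.+ s) (foldr-+-tabulate f (λ i → h (Fin.suc i)))

  PS-sum-coeff : ∀ {m} (v : Fin m → PS) k → PS-sum.sum v k ≡ ℤ-sum.sum (λ z → v z k)
  PS-sum-coeff {zero}  v k = refl
  PS-sum-coeff {suc m} v k = cong (λ s → v Fin.zero k ℤ.+ s) (PS-sum-coeff (λ z → v (Fin.suc z)) k)

  foldr-+-filterᵇ-cong : ∀ {A : Set} (b : A → Bool) {f g : A → ℤ} xs → (∀ z → b z ≡ true → f z ≡ g z) →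
    foldr-+ f (filterᵇ b xs) ≡ foldr-+ g (filterᵇ b xs)
  foldr-+-filterᵇ-cong b []       f≗g = refl
  foldr-+-filterᵇ-cong b (x ∷ xs) f≗g with b x in bx
  ... | true  = cong₂ ℤ._+_ (f≗g x bx) (foldr-+-filterᵇ-cong b xs f≗g)
  ... | false = foldr-+-filterᵇ-cong b xs f≗g

  foldr-+-filterᵇ-none : ∀ {A : Set} (b : A → Bool) (f : A → ℤ) xs → (∀ z → b z ≡ false) → foldr-+ f (filterᵇ b xs) ≡ + 0
  foldr-+-filterᵇ-none b f []       b≗false = refl
  foldr-+-filterᵇ-none b f (x ∷ xs) b≗false rewrite b≗false x = foldr-+-filterᵇ-none b f xs b≗false

  module _ {A : Set} where

    length-filterᵇ-mono : ∀ {b b′ : A → Bool} xs → (∀ z → b z ≡ true → b′ z ≡ true) →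
      length (filterᵇ b xs) ≤ length (filterᵇ b′ xs)
    length-filterᵇ-mono []       b⊆b′ = z≤n
    length-filterᵇ-mono {b} {b′} (x ∷ xs) b⊆b′ with b x in bx | b′ x in b′x
    ... | true  | true  = s≤s (length-filterᵇ-mono xs b⊆b′)
    ... | true  | false = contradiction (trans (sym (b⊆b′ x bx)) b′x) λ ()
    ... | false | true  = ℕ.m≤n⇒m≤1+n (length-filterᵇ-mono xs b⊆b′)
    ... | false | false = length-filterᵇ-mono xs b⊆b′

    length-filterᵇ-mono-< : ∀ {b b′ : A → Bool} {w} xs → (∀ z → b z ≡ true → b′ z ≡ true) →
      w ∈ xs → b′ w ≡ true → b w ≡ false → length (filterᵇ b xs) < length (filterᵇ b′ xs)
    length-filterᵇ-mono-< {b} {b′} (x ∷ xs) b⊆b′ (here refl) b′w bw rewrite bw | b′w =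
      s≤s (length-filterᵇ-mono xs b⊆b′)
    length-filterᵇ-mono-< {b} {b′} (x ∷ xs) b⊆b′ (there w∈xs) b′w bw with b x in bx | b′ x in b′x
    ... | true  | true  = s≤s (length-filterᵇ-mono-< xs b⊆b′ w∈xs b′w bw)
    ... | true  | false = contradiction (trans (sym (b⊆b′ x bx)) b′x) λ ()
    ... | false | true  = ℕ.m≤n⇒m≤1+n (length-filterᵇ-mono-< xs b⊆b′ w∈xs b′w bw)
    ... | false | false = length-filterᵇ-mono-< xs b⊆b′ w∈xs b′w bw

  module _ (P : RawGradedPoset) where
    open RawGradedPoset P
    open Chow P

    Σℤ-as-sum : ∀ b f → Σℤ b f ≡ ℤ-sum.sum (λ z → if b z then f z else + 0)
    Σℤ-as-sum b f = trans (foldr-+-filterᵇ b f (allFin n)) (foldr-+-tabulate (λ z → if b z then f z else + 0) id)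

    Σₚ-as-sum : ∀ b f → Σₚ b f ≈ₚ PS-sum.sum (λ z → if b z then f z else 0ₚ)
    Σₚ-as-sum b f k = trans (Σℤ-as-sum b (λ z → f z k))
      (sym (trans (PS-sum-coeff (λ z → if b z then f z else 0ₚ) k) (ℤ-sum.sum-cong-≗ (λ z → coeff-if (b z) (f z)))))
      where
      coeff-if : ∀ c p → (if c then p else 0ₚ) k ≡ (if c then p k else + 0)
      coeff-if true  p = refl
      coeff-if false p = refl

    Σℤ-cong : ∀ b {f g} → (∀ z → b z ≡ true → f z ≡ g z) → Σℤ b f ≡ Σℤ b g
    Σℤ-cong b = foldr-+-filterᵇ-cong b (allFin n)

    Σℤ-none : ∀ b f → (∀ z → b z ≡ false) → Σℤ b f ≡ + 0
    Σℤ-none b f = foldr-+-filterᵇ-none b f (allFin n)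

module Posets where

  open PowerSeries
  open Matrices
  open Filters
  open import Algebra.Bundles using (CommutativeRing)
  import Algebra.Properties.Semiring.Sum as SemiringSum
  open import Data.Bool using (Bool; true; false; _∧_; if_then_else_)
  open import Data.Bool.Properties using (¬-not; ∧-zeroʳ)
  open import Data.Fin using (Fin; _≟_)
  open import Data.Integer as ℤ using (+_; -_)
  open import Data.List using (length; filterᵇ; allFin)
  open import Data.List.Membership.Propositional.Properties using (∈-allFin)
  import Data.List.Properties as List
  open import Data.Nat as ℕ using (zero; suc; _∸_; _≤_; _<_; z≤n; s≤s)
  import Data.Nat.Properties as ℕ
  import Data.Integer.Properties as ℤ
  open import Data.Integer.Tactic.RingSolver using (solve-∀)
  open import Data.Product using (_×_; _,_; proj₁; proj₂)
  open import Data.Sum using (_⊎_; inj₁; inj₂)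
  open import Function using (_∘_; id)
  open import Relation.Binary.Structures using (IsPartialOrder)
  open import Relation.Binary.PropositionalEquality as ≡ using (_≢_; refl)
  open import Relation.Nullary using (¬_; contradiction; yes; no)
  open import Relation.Nullary.Decidable using (dec-true; dec-false)

  ∧≡true⁻ : ∀ {a b} → a ∧ b ≡ true → a ≡ true × b ≡ true
  ∧≡true⁻ {true} {true} _ = refl , refl

  ∧≡true⁺ : ∀ {a b} → a ≡ true → b ≡ true → a ∧ b ≡ true
  ∧≡true⁺ refl refl = refl

  module Properties (Q : RawGradedPoset) (isPartialOrder : IsPartialOrder _≡_ (Le Q)) where
    open RawGradedPoset Q
    open Chow Q public
    open IsPartialOrder isPartialOrder public using (reflexive; antisym) renaming (refl to ≼-refl; trans to ≼-trans)

    infix 4 _≼_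
    _≼_ : Fin n → Fin n → Set
    _≼_ = Le Q

    eqᵇ-refl : ∀ x → eqᵇ x x ≡ true
    eqᵇ-refl x = dec-true (x ≟ x) refl

    ≢⇒eqᵇ≡false : ∀ {x y} → x ≢ y → eqᵇ x y ≡ false
    ≢⇒eqᵇ≡false {x} {y} = dec-false (x ≟ y)

    ⋠⇒le≡false : ∀ {x y} → ¬ x ≼ y → le x y ≡ false
    ⋠⇒le≡false = ¬-not

    le≡false⇒⋠ : ∀ {x y} → le x y ≡ false → ¬ x ≼ y
    le≡false⇒⋠ x≰y x≼y = contradiction (≡.trans (≡.sym x≼y) x≰y) λ ()

    ⋠⇒≢ : ∀ {x y} → ¬ x ≼ y → x ≢ y
    ⋠⇒≢ x⋠y = x⋠y ∘ reflexive

    ltᵇ-sound : ∀ {x y} → ltᵇ x y ≡ true → x ≼ y × x ≢ y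
    ltᵇ-sound {x} {y} x<y with le x y | x ≟ y
    ltᵇ-sound () | false | _
    ltᵇ-sound () | true  | yes _
    ... | true | no x≢y = refl , x≢y

    ltᵇ-complete : ∀ {x y} → x ≼ y → x ≢ y → ltᵇ x y ≡ true
    ltᵇ-complete x≼y x≢y rewrite x≼y | ≢⇒eqᵇ≡false x≢y = refl

    inInterval : Fin n → Fin n → Fin n → Bool
    inInterval x y z = le x z ∧ le z y

    subinterval : ∀ {x y x′ y′} → x ≼ x′ → y′ ≼ y → ∀ z → inInterval x′ y′ z ≡ true → inInterval x y z ≡ true
    subinterval x≼x′ y′≼y z z∈[x′,y′] with ∧≡true⁻ z∈[x′,y′]
    ... | x′≼z , z≼y′ = ∧≡true⁺ (≼-trans x≼x′ x′≼z) (≼-trans z≼y′ y′≼y)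

    interval-empty : ∀ {x y} → ¬ x ≼ y → ∀ z → inInterval x y z ≡ false
    interval-empty x⋠y z = ¬-not λ z∈ → x⋠y (≼-trans (proj₁ (∧≡true⁻ z∈)) (proj₂ (∧≡true⁻ z∈)))

    outside-interval : ∀ {x y z} → inInterval x y z ≡ false → ¬ x ≼ z ⊎ ¬ z ≼ y
    outside-interval {x} {y} {z} z∉ with le x z
    ... | false = inj₁ λ ()
    ... | true  = inj₂ (le≡false⇒⋠ z∉)

    ∈[_,_⟩ : Fin n → Fin n → Fin n → Bool
    ∈[ x , y ⟩ z = le x z ∧ ltᵇ z y

    ∈⟨_,_] : Fin n → Fin n → Fin n → Bool
    ∈⟨ x , y ] z = ltᵇ x z ∧ le z y

    ∈⟨]-empty : ∀ {x y} → ¬ x ≼ y → ∀ z → ∈⟨ x , y ] z ≡ false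
    ∈⟨]-empty x⋠y z = ¬-not λ z∈ → x⋠y (≼-trans (proj₁ (ltᵇ-sound (proj₁ (∧≡true⁻ z∈)))) (proj₂ (∧≡true⁻ z∈)))

    size : Fin n → Fin n → ℕ
    size x y = length (filterᵇ (inInterval x y) (allFin n))

    size≤n : ∀ x y → size x y ≤ n
    size≤n x y = ℕ.≤-trans (List.length-filter _ (allFin n)) (ℕ.≤-reflexive (List.length-tabulate id))

    size-pos : ∀ {x y} → x ≼ y → 0 < size x y
    size-pos {x} {y} x≼y = ℕ.≤-<-trans z≤n
      (length-filterᵇ-mono-< {b = λ _ → false} (allFin n) (λ _ ()) (∈-allFin x) (∧≡true⁺ ≼-refl x≼y) refl)

    size-shrinks : ∀ {x y x′ y′} → x ≼ x′ → x′ ≼ y′ → y′ ≼ y → x ≢ x′ ⊎ y′ ≢ y → size x′ y′ < size x y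
    size-shrinks {x} {y} {x′} {y′} x≼x′ x′≼y′ y′≼y = λ where
        (inj₁ x≢x′) → shrink x (∧≡true⁺ ≼-refl x≼y) (≡.cong (_∧ le x y′) (⋠⇒le≡false (x≢x′ ∘ antisym x≼x′)))
        (inj₂ y′≢y) → shrink y (∧≡true⁺ x≼y ≼-refl)
                        (≡.trans (≡.cong (le x′ y ∧_) (⋠⇒le≡false (y′≢y ∘ antisym y′≼y))) (∧-zeroʳ (le x′ y)))
      where
      x≼y : x ≼ y
      x≼y = ≼-trans x≼x′ (≼-trans x′≼y′ y′≼y)
      shrink : ∀ w → inInterval x y w ≡ true → inInterval x′ y′ w ≡ false → size x′ y′ < size x y
      shrink w = length-filterᵇ-mono-< (allFin n) (subinterval x≼x′ y′≼y) (∈-allFin w)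

    ∈[⟩-size : ∀ {x y z} → ∈[ x , y ⟩ z ≡ true → size x z < size x y
    ∈[⟩-size {x} {y} {z} z∈ with ∧≡true⁻ {le x z} z∈
    ... | x≼z , z<y with ltᵇ-sound z<y
    ...   | z≼y , z≢y = size-shrinks ≼-refl x≼z z≼y (inj₂ z≢y)

    ∈⟨]-size : ∀ {x y z} → ∈⟨ x , y ] z ≡ true → size z y < size x y
    ∈⟨]-size {x} {y} {z} z∈ with ∧≡true⁻ {ltᵇ x z} z∈
    ... | x<z , z≼y with ltᵇ-sound x<z
    ...   | x≼z , x≢z = size-shrinks x≼z z≼y ≼-refl (inj₁ x≢z)

    interval-induction : ∀ {p} (Pred : Fin n → Fin n → Set p) →
      (∀ x y → (∀ x′ y′ → size x′ y′ < size x y → Pred x′ y′) → Pred x y) → ∀ x y → Pred x y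
    interval-induction Pred step x y = go (suc n) x y (s≤s (size≤n x y))
      where
      go : ∀ f x y → size x y < f → Pred x y
      go (suc f) x y size<1+f = step x y λ x′ y′ smaller → go f x′ y′ (ℕ.<-≤-trans smaller (ℕ.≤-pred size<1+f))

    -- μ and H̲ are defined with fuel n; a recursion that only consults strictly smaller
    -- intervals has already stabilised at that fuel.
    fuel-stable : ∀ {a ℓ} {A : Set a} (_∼_ : A → A → Set ℓ) (F : ℕ → Fin n → Fin n → A) →
      (∀ x y → ¬ x ≼ y → F 0 x y ∼ F 1 x y) →
      (∀ f x y → (∀ x′ y′ → size x′ y′ < size x y → F f x′ y′ ∼ F (suc f) x′ y′) →
                 F (suc f) x y ∼ F (suc (suc f)) x y) →
      ∀ x y → F n x y ∼ F (suc n) x y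
    fuel-stable {ℓ = ℓ} _∼_ F base step x y = interval-induction Stable stable x y n (size≤n x y)
      where
      Stable : Fin n → Fin n → Set ℓ
      Stable x y = ∀ f → size x y ≤ f → F f x y ∼ F (suc f) x y
      stable : ∀ x y → (∀ x′ y′ → size x′ y′ < size x y → Stable x′ y′) → Stable x y
      stable x y ih zero    size≤0   = base x y (λ x≼y → ℕ.<⇒≱ (size-pos x≼y) size≤0)
      stable x y ih (suc f) size≤1+f = step f x y λ x′ y′ smaller →
        ih x′ y′ smaller f (ℕ.≤-pred (ℕ.≤-trans smaller size≤1+f))

    μ-fuel-off : ∀ f {x y} → ¬ x ≼ y → μ-fuel f x y ≡ + 0
    μ-fuel-off zero    x⋠y = refl
    μ-fuel-off (suc f) x⋠y rewrite ≢⇒eqᵇ≡false (⋠⇒≢ x⋠y) | ⋠⇒le≡false x⋠y = refl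

    μ-fuel-stable : ∀ x y → μ-fuel n x y ≡ μ-fuel (suc n) x y
    μ-fuel-stable = fuel-stable _≡_ μ-fuel (λ x y x⋠y → ≡.trans (μ-fuel-off 0 x⋠y) (≡.sym (μ-fuel-off 1 x⋠y))) step
      where
      step : ∀ f x y → (∀ x′ y′ → size x′ y′ < size x y → μ-fuel f x′ y′ ≡ μ-fuel (suc f) x′ y′) →
             μ-fuel (suc f) x y ≡ μ-fuel (suc (suc f)) x y
      step f x y agree with eqᵇ x y | le x y
      ... | true  | _     = refl
      ... | false | false = refl
      ... | false | true  = ≡.cong -_ (Σℤ-cong Q ∈[ x , y ⟩ λ z z∈ → agree x z (∈[⟩-size z∈))

    μ-diag : ∀ x → μ x x ≡ + 1
    μ-diag x rewrite μ-fuel-stable x x | eqᵇ-refl x = refl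

    μ-step : ∀ {x y} → x ≼ y → x ≢ y → μ x y ≡ - Σℤ ∈[ x , y ⟩ (μ x)
    μ-step {x} {y} x≼y x≢y rewrite μ-fuel-stable x y | ≢⇒eqᵇ≡false x≢y | x≼y = refl

    μ-off : ∀ {x y} → ¬ x ≼ y → μ x y ≡ + 0
    μ-off = μ-fuel-off n

    H-fuel-off : ∀ f {x y} → ¬ x ≼ y → H-fuel f x y ≈ₚ 0ₚ
    H-fuel-off zero    x⋠y _ = refl
    H-fuel-off (suc f) {x} {y} x⋠y k rewrite ≢⇒eqᵇ≡false (⋠⇒≢ x⋠y) =
      Σℤ-none Q ∈⟨ x , y ] (λ z → (χ̄ x z *ₚ H-fuel f z y) k) (∈⟨]-empty x⋠y)

    H-fuel-stable : ∀ x y → H-fuel n x y ≈ₚ H-fuel (suc n) x y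
    H-fuel-stable = fuel-stable _≈ₚ_ H-fuel (λ x y x⋠y k → ≡.sym (H-fuel-off 1 x⋠y k)) step
      where
      step : ∀ f x y → (∀ x′ y′ → size x′ y′ < size x y → H-fuel f x′ y′ ≈ₚ H-fuel (suc f) x′ y′) →
             H-fuel (suc f) x y ≈ₚ H-fuel (suc (suc f)) x y
      step f x y agree with eqᵇ x y
      ... | true  = λ _ → refl
      ... | false = λ k → Σℤ-cong Q ∈⟨ x , y ] λ z z∈ → *ₚ-congˡ (χ̄ x z) (agree z y (∈⟨]-size z∈)) k

    H-diag : ∀ x → H̲ x x ≈ₚ 1ₚ
    H-diag x k rewrite H-fuel-stable x x k | eqᵇ-refl x = refl

    H-step : ∀ {x y} → x ≢ y → H̲ x y ≈ₚ Σₚ ∈⟨ x , y ] (λ z → χ̄ x z *ₚ H̲ z y)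
    H-step {x} {y} x≢y k rewrite H-fuel-stable x y k | ≢⇒eqᵇ≡false x≢y = refl

    H-off : ∀ {x y} → ¬ x ≼ y → H̲ x y ≈ₚ 0ₚ
    H-off = H-fuel-off n

    module Incidence {c ℓ} (R : CommutativeRing c ℓ) where
      open CommutativeRing R hiding (refl)
      open SquareMatrices R n
      open Sums R using (sum-zero; sum-single)
      open SemiringSum semiring using (sum)

      Triangular : Matrix → Set ℓ
      Triangular A = ∀ {x y} → ¬ x ≼ y → A x y ≈ 0#

      product-outside : ∀ {A B} → Triangular A → Triangular B → ∀ {x y z} → inInterval x y z ≡ false → A x z * B z y ≈ 0#
      product-outside {A} {B} A▵ B▵ {x} {y} {z} z∉ with outside-interval z∉
      ... | inj₁ x⋠z = trans (*-congʳ (A▵ x⋠z)) (zeroˡ (B z y))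
      ... | inj₂ z⋠y = trans (*-congˡ (B▵ z⋠y)) (zeroʳ (A x z))

      ⊗-triangular : ∀ {A B} → Triangular A → Triangular B → Triangular (A ⊗ B)
      ⊗-triangular A▵ B▵ x⋠y = sum-zero λ z → product-outside A▵ B▵ (interval-empty x⋠y z)

      ⊗-diagonal : ∀ {A B} → Triangular A → Triangular B → ∀ x → (A ⊗ B) x x ≈ A x x * B x x
      ⊗-diagonal {A} {B} A▵ B▵ x = sum-single x vanish
        where
        vanish : ∀ z → z ≢ x → A x z * B z x ≈ 0#
        vanish z z≢x with le x z in x≤z
        ... | true  = trans (*-congˡ (B▵ (λ z≼x → z≢x (antisym z≼x x≤z)))) (zeroʳ (A x z))
        ... | false = trans (*-congʳ (A▵ (le≡false⇒⋠ x≤z))) (zeroˡ (B z x))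

      ⊗-split-first : ∀ {A B} → Triangular A → Triangular B → ∀ x y →
        (A ⊗ B) x y ≈ A x x * B x y + sum (λ z → if ∈⟨ x , y ] z then A x z * B z y else 0#)
      ⊗-split-first {A} {B} A▵ B▵ x y = sum-split x (A x x * B x y) decompose
        where
        decompose : ∀ z → A x z * B z y ≈ diag (A x x * B x y) z x + (if ∈⟨ x , y ] z then A x z * B z y else 0#)
        decompose z with z ≟ x
        ... | yes refl rewrite ≼-refl {z} | eqᵇ-refl z = sym (+-identityʳ _)
        ... | no z≢x rewrite ≢⇒eqᵇ≡false (z≢x ∘ ≡.sym) with le x z in x≤z | le z y in z≤y
        ...   | true  | true  = sym (+-identityˡ _)
        ...   | true  | false = trans (product-outside A▵ B▵ (≡.cong₂ _∧_ x≤z z≤y)) (sym (+-identityˡ 0#))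
        ...   | false | _     = trans (product-outside A▵ B▵ (≡.cong (_∧ le z y) x≤z)) (sym (+-identityˡ 0#))

      ⊗-split-last : ∀ {A B} → Triangular A → Triangular B → ∀ x y →
        (A ⊗ B) x y ≈ A x y * B y y + sum (λ z → if ∈[ x , y ⟩ z then A x z * B z y else 0#)
      ⊗-split-last {A} {B} A▵ B▵ x y = sum-split y (A x y * B y y) decompose
        where
        decompose : ∀ z → A x z * B z y ≈ diag (A x y * B y y) z y + (if ∈[ x , y ⟩ z then A x z * B z y else 0#)
        decompose z with z ≟ y
        ... | yes refl rewrite ≼-refl {z} | ∧-zeroʳ (le x z) = sym (+-identityʳ _)
        ... | no z≢y with le x z in x≤z | le z y in z≤y
        ...   | true  | true  = sym (+-identityˡ _)
        ...   | true  | false = trans (product-outside A▵ B▵ (≡.cong₂ _∧_ x≤z z≤y)) (sym (+-identityˡ 0#))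
        ...   | false | _     = trans (product-outside A▵ B▵ (≡.cong (_∧ le z y) x≤z)) (sym (+-identityˡ 0#))

    module ℤM = SquareMatrices ℤ.+-*-commutativeRing n
    open Incidence ℤ.+-*-commutativeRing using () renaming
      (Triangular to Triangularℤ; ⊗-triangular to ⊗-triangularℤ; ⊗-diagonal to ⊗-diagonalℤ; ⊗-split-last to ⊗-split-lastℤ)

    ζ : ℤM.Matrix
    ζ x y = if le x y then + 1 else + 0

    ζ-triangular : Triangularℤ ζ
    ζ-triangular x⋠y rewrite ⋠⇒le≡false x⋠y = refl

    μ⊗ζ≋1 : μ ℤM.⊗ ζ ℤM.≋ ℤM.diag (+ 1)
    μ⊗ζ≋1 x y with x ≟ y
    ... | yes refl rewrite ⊗-diagonalℤ μ-off ζ-triangular x | μ-diag x | ≼-refl {x} = refl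
    ... | no x≢y with le x y in x≤y
    ...   | false = ⊗-triangularℤ μ-off ζ-triangular (le≡false⇒⋠ x≤y)
    ...   | true  = begin
      (μ ℤM.⊗ ζ) x y                                     ≡⟨ ⊗-split-lastℤ μ-off ζ-triangular x y ⟩
      μ x y ℤ.* ζ y y ℤ.+ ℤ-sum.sum (λ z → if ∈[ x , y ⟩ z then μ x z ℤ.* ζ z y else + 0)
        ≡⟨ ≡.cong₂ ℤ._+_ (≡.cong (μ x y ℤ.*_) ζ-refl) (≡.sym (Σℤ-as-sum Q ∈[ x , y ⟩ _)) ⟩
      μ x y ℤ.* + 1 ℤ.+ Σℤ ∈[ x , y ⟩ (λ z → μ x z ℤ.* ζ z y)
        ≡⟨ ≡.cong₂ ℤ._+_ (ℤ.*-identityʳ (μ x y)) (Σℤ-cong Q ∈[ x , y ⟩ drop-ζ) ⟩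
      μ x y ℤ.+ Σℤ ∈[ x , y ⟩ (μ x)                      ≡⟨ ≡.cong (ℤ._+ Σℤ ∈[ x , y ⟩ (μ x)) (μ-step x≤y x≢y) ⟩
      - Σℤ ∈[ x , y ⟩ (μ x) ℤ.+ Σℤ ∈[ x , y ⟩ (μ x)      ≡⟨ ℤ.+-inverseˡ (Σℤ ∈[ x , y ⟩ (μ x)) ⟩
      + 0                                                ∎
      where
      open ≡.≡-Reasoning
      ζ-refl : ζ y y ≡ + 1
      ζ-refl rewrite ≼-refl {y} = refl
      drop-ζ : ∀ z → ∈[ x , y ⟩ z ≡ true → μ x z ℤ.* ζ z y ≡ μ x z
      drop-ζ z z∈ rewrite proj₁ (ltᵇ-sound (proj₂ (∧≡true⁻ {le x z} z∈))) = ℤ.*-identityʳ (μ x z)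

    module PM = SquareMatrices powerSeriesRing n
    open Incidence powerSeriesRing using (Triangular; product-outside; ⊗-triangular; ⊗-diagonal; ⊗-split-first)
    open PM using (_⊗_; _⊖_; diag)

    μₚ : PM.Matrix
    μₚ x y = constₚ (μ x y)

    ζₜ : PM.Matrix
    ζₜ x y = if le x y then tpow (ρ y ∸ ρ x) else 0ₚ

    tI [t-1]I : PM.Matrix
    tI = diag (tpow 1)
    [t-1]I = diag t-1

    μₚ-triangular : Triangular μₚ
    μₚ-triangular {x} {y} x⋠y k rewrite μ-off x⋠y = ℤ.*-zeroˡ (1ₚ k)

    ζₜ-triangular : Triangular ζₜ
    ζₜ-triangular x⋠y _ rewrite ⋠⇒le≡false x⋠y = refl

    χ≋μₚ⊗ζₜ : ∀ x y → χ x y ≈ₚ (μₚ ⊗ ζₜ) x y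
    χ≋μₚ⊗ζₜ x y k = ≡.trans (Σₚ-as-sum Q (inInterval x y) _ k) (sum-indicator (inInterval x y) inside outside k)
      where
      open Sums powerSeriesRing using (sum-indicator)
      inside : ∀ z → inInterval x y z ≡ true → scaleₚ (μ x z) (tpow (ρ y ∸ ρ z)) ≈ₚ μₚ x z *ₚ ζₜ z y
      inside z z∈ rewrite proj₂ (∧≡true⁻ {le x z} z∈) = λ k → ≡.sym (constₚ-*ₚ (μ x z) (tpow (ρ y ∸ ρ z)) k)
      outside : ∀ z → inInterval x y z ≡ false → μₚ x z *ₚ ζₜ z y ≈ₚ 0ₚ
      outside z = product-outside μₚ-triangular ζₜ-triangular

    χ-triangular : Triangular χ
    χ-triangular {x} {y} x⋠y k = ≡.trans (χ≋μₚ⊗ζₜ x y k) (⊗-triangular μₚ-triangular ζₜ-triangular x⋠y k)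

    χ-diag : ∀ x → χ x x ≈ₚ 1ₚ
    χ-diag x k = begin
      χ x x k                         ≡⟨ χ≋μₚ⊗ζₜ x x k ⟩
      (μₚ ⊗ ζₜ) x x k                 ≡⟨ ⊗-diagonal μₚ-triangular ζₜ-triangular x k ⟩
      (μₚ x x *ₚ ζₜ x x) k            ≡⟨ constₚ-*ₚ (μ x x) (ζₜ x x) k ⟩
      μ x x ℤ.* ζₜ x x k              ≡⟨ ≡.cong₂ ℤ._*_ (μ-diag x) ζₜ-diag ⟩
      + 1 ℤ.* 1ₚ k                    ≡⟨ ℤ.*-identityˡ (1ₚ k) ⟩
      1ₚ k                            ∎
      where
      open ≡.≡-Reasoning
      ζₜ-diag : ζₜ x x k ≡ 1ₚ k
      ζₜ-diag rewrite ≼-refl {x} | ℕ.n∸n≡0 (ρ x) = refl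

    χ̄-triangular : Triangular χ̄
    χ̄-triangular {x} {y} x⋠y k rewrite ≢⇒eqᵇ≡false (⋠⇒≢ x⋠y) =
      ≡.cong -_ (sumUpTo-zero (χ x y) k λ i _ → χ-triangular x⋠y i)

    [t-1]χ̄ : ∀ x y → (t-1 *ₚ χ̄ x y) ≈ₚ (χ ⊖ tI) x y
    [t-1]χ̄ x y k with x ≟ y
    ... | no x≢y = ≡.trans (t-1*div-t-1 (χ x y) k) (≡.sym (ℤ.+-identityʳ (χ x y k)))
    ... | yes refl = begin
      (t-1 *ₚ constₚ (- + 1)) k          ≡⟨ *ₚ-comm t-1 (constₚ (- + 1)) k ⟩
      (constₚ (- + 1) *ₚ t-1) k          ≡⟨ constₚ-*ₚ (- + 1) t-1 k ⟩
      - + 1 ℤ.* (tpow 1 k ℤ.- 1ₚ k)       ≡⟨ negate-difference (tpow 1 k) (1ₚ k) ⟩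
      1ₚ k ℤ.- tpow 1 k                  ≡⟨ ≡.cong (ℤ._- tpow 1 k) (χ-diag x k) ⟨
      χ x x k ℤ.- tpow 1 k               ∎
      where
      open ≡.≡-Reasoning
      negate-difference : ∀ a b → - + 1 ℤ.* (a ℤ.- b) ≡ b ℤ.- a
      negate-difference = solve-∀

    χ̄-diag : ∀ x → χ̄ x x ≡ constₚ (- + 1)
    χ̄-diag x rewrite eqᵇ-refl x = refl

    χ̄⊗H̲≋-1 : ∀ x y → (χ̄ ⊗ H̲) x y ≈ₚ (-ₚ diag 1ₚ x y)
    χ̄⊗H̲≋-1 x y k with x ≟ y
    ... | yes refl = begin
      (χ̄ ⊗ H̲) x x k                    ≡⟨ ⊗-diagonal χ̄-triangular H-off x k ⟩
      (χ̄ x x *ₚ H̲ x x) k               ≡⟨ ≡.cong (λ c → (c *ₚ H̲ x x) k) (χ̄-diag x) ⟩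
      (constₚ (- + 1) *ₚ H̲ x x) k      ≡⟨ constₚ-*ₚ (- + 1) (H̲ x x) k ⟩
      - + 1 ℤ.* H̲ x x k                ≡⟨ ℤ.-1*i≡-i (H̲ x x k) ⟩
      - H̲ x x k                        ≡⟨ ≡.cong -_ (H-diag x k) ⟩
      - 1ₚ k                           ∎
      where open ≡.≡-Reasoning
    ... | no x≢y = begin
      (χ̄ ⊗ H̲) x y k                                        ≡⟨ ⊗-split-first χ̄-triangular H-off x y k ⟩
      (χ̄ x x *ₚ H̲ x y) k ℤ.+ PS-sum.sum later k
        ≡⟨ ≡.cong₂ ℤ._+_ (≡.cong (λ c → (c *ₚ H̲ x y) k) (χ̄-diag x))
                         (≡.sym (≡.trans (H-step x≢y k) (Σₚ-as-sum Q ∈⟨ x , y ] _ k))) ⟩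
      (constₚ (- + 1) *ₚ H̲ x y) k ℤ.+ H̲ x y k             ≡⟨ ≡.cong (ℤ._+ H̲ x y k) (constₚ-*ₚ (- + 1) (H̲ x y) k) ⟩
      - + 1 ℤ.* H̲ x y k ℤ.+ H̲ x y k                       ≡⟨ ≡.cong (ℤ._+ H̲ x y k) (ℤ.-1*i≡-i (H̲ x y k)) ⟩
      - H̲ x y k ℤ.+ H̲ x y k                               ≡⟨ ℤ.+-inverseˡ (H̲ x y k) ⟩
      + 0                                                 ∎
      where
      open ≡.≡-Reasoning
      later : Fin n → PS
      later z = if ∈⟨ x , y ] z then χ̄ x z *ₚ H̲ z y else 0ₚ

    G≈ζₜ⊗H̲ : (∀ z → bot ≼ z) → ρ bot ≡ 0 → G ≈ₚ (ζₜ ⊗ H̲) bot top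
    G≈ζₜ⊗H̲ bot-min ρ-bot k = ≡.trans (Σₚ-as-sum Q (λ _ → true) _ k)
      (PS-sum.sum-cong-≋ (λ z → *ₚ-congʳ (H̲ z top) (rank z)) k)
      where
      rank : ∀ z → tpow (ρ z) ≈ₚ ζₜ bot z
      rank z _ rewrite bot-min z | ρ-bot = refl

    resolvent : (tI ⊖ μₚ ⊗ ζₜ) ⊗ H̲ PM.≋ [t-1]I
    resolvent = negate-inverse χ̄ H̲ [t-1]I (μₚ ⊗ ζₜ) tI
      (λ x y k → ≡.trans (PM.diag-⊗ t-1 χ̄ x y k) (≡.trans ([t-1]χ̄ x y k) (≡.cong (ℤ._- tI x y k) (χ≋μₚ⊗ζₜ x y k))))
      χ̄⊗H̲≋-1
      where open RingLemmas PM.matrixRing using (negate-inverse)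

module SelfDuality where

  open PowerSeries
  open Matrices
  open Filters
  open Posets
  open import Algebra.Bundles using (Ring)
  open import Data.Bool using (true; false; _∧_)
  import Data.Bool as Bool
  open import Data.Fin using (_≟_)
  open import Data.Fin.Properties using (any?)
  open import Data.Integer as ℤ using (+_; -_)
  import Data.Integer.Properties as ℤ
  open import Data.Nat as ℕ using (_∸_; _+_; _≤_; _<_)
  import Data.Nat.Properties as ℕ
  open import Data.Product using (_,_)
  open import Data.Sum using (_⊎_; inj₁; inj₂)
  open import Function using (_∘_)
  open import Relation.Binary.Structures using (IsPartialOrder)
  import Relation.Binary.Construct.Flip.EqAndOrd as Flip
  open import Relation.Binary.PropositionalEquality as ≡ using (refl)
  open import Relation.Nullary using (yes; no; contradiction)

  [o∸m]∸[o∸n]≡n∸m : ∀ {m n o} → m ≤ n → n ≤ o → (o ∸ m) ∸ (o ∸ n) ≡ n ∸ m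
  [o∸m]∸[o∸n]≡n∸m {m} {n} {o} m≤n n≤o = begin
    (o ∸ m) ∸ (o ∸ n)               ≡⟨ ≡.cong (λ k → (k ∸ m) ∸ (o ∸ n)) (ℕ.m∸n+n≡m n≤o) ⟨
    ((o ∸ n) + n ∸ m) ∸ (o ∸ n)     ≡⟨ ≡.cong (_∸ (o ∸ n)) (ℕ.+-∸-assoc (o ∸ n) m≤n) ⟩
    ((o ∸ n) + (n ∸ m)) ∸ (o ∸ n)   ≡⟨ ℕ.m+n∸m≡n (o ∸ n) (n ∸ m) ⟩
    n ∸ m                           ∎
    where open ≡.≡-Reasoning

  isPartialOrder : ∀ {P} → IsBoundedGraded P → IsPartialOrder _≡_ (Le P)
  isPartialOrder isBounded = record
    { isPreorder = record
      { isEquivalence = ≡.isEquivalence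
      ; reflexive = λ { ≡.refl → B.refl _ }
      ; trans = B.trans _ _ _ }
    ; antisym = B.antisym _ _ }
    where module B = IsBoundedGraded isBounded

  module Duality (P : BoundedGradedPoset) where
    open BoundedGradedPoset P
    open IsBoundedGraded isBounded using (top-max; ρ-cover)

    module Q = Properties raw (isPartialOrder isBounded)
    module D = Properties (dual raw) (Flip.isPartialOrder (isPartialOrder isBounded))
    open Q using (_≼_; ≼-refl; size; interval-induction; size-shrinks; ltᵇ-sound; ltᵇ-complete)

    ρ-mono : ∀ {x y} → x ≼ y → ρ x ≤ ρ y
    ρ-mono {x} {y} = interval-induction (λ x y → x ≼ y → ρ x ≤ ρ y) step x y
      where
      step : ∀ x y → (∀ x′ y′ → size x′ y′ < size x y → x′ ≼ y′ → ρ x′ ≤ ρ y′) → x ≼ y → ρ x ≤ ρ y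
      step x y ih x≼y with x ≟ y
      ... | yes refl = ℕ.≤-refl
      ... | no x≢y with any? (λ z → Q.ltᵇ x z ∧ Q.ltᵇ z y Bool.≟ true)
      ...   | yes (z , x<z<y) with ∧≡true⁻ {Q.ltᵇ x z} x<z<y
      ...     | x<z , z<y with ltᵇ-sound x<z | ltᵇ-sound z<y
      ...       | x≼z , x≢z | z≼y , z≢y = ℕ.≤-trans
        (ih x z (size-shrinks ≼-refl x≼z z≼y (inj₂ z≢y)) x≼z)
        (ih z y (size-shrinks x≼z z≼y ≼-refl (inj₁ x≢z)) z≼y)
      step x y ih x≼y | no x≢y | no nothingBetween =
        ℕ.≤-trans (ℕ.n≤1+n (ρ x)) (ℕ.≤-reflexive (≡.sym (ρ-cover x y (x≼y , x≢y , covers))))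
        where
        covers : ∀ z → x ≼ z → z ≼ y → z ≡ x ⊎ z ≡ y
        covers z x≼z z≼y with z ≟ x | z ≟ y
        ... | yes z≡x | _       = inj₁ z≡x
        ... | no _    | yes z≡y = inj₂ z≡y
        ... | no z≢x  | no z≢y  = contradiction
          (z , ∧≡true⁺ (ltᵇ-complete x≼z (z≢x ∘ ≡.sym)) (ltᵇ-complete z≼y z≢y)) nothingBetween

    μ-self-dual : ∀ x y → D.μ y x ≡ Q.μ x y
    μ-self-dual x y = ≡.sym (left-inverse≈right-inverse (Q.μ) Q.ζ (D.μ ᵀ) Q.μ⊗ζ≋1 ζ⊗μᵈᵀ≋1 x y)
      where
      open Q.ℤM using (_⊗_; _ᵀ; _≋_; diag; ⊗-ᵀ; diag-ᵀ; matrixRing)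
      open RingLemmas matrixRing using (left-inverse≈right-inverse)
      ζ⊗μᵈᵀ≋1 : Q.ζ ⊗ (D.μ ᵀ) ≋ diag (+ 1)
      ζ⊗μᵈᵀ≋1 x y = ≡.trans (≡.sym (⊗-ᵀ (D.μ) D.ζ x y)) (≡.trans (D.μ⊗ζ≋1 y x) (diag-ᵀ (+ 1) x y))

    open Q.PM using (_≋_; _⊗_; _⊖_; _ᵀ; ⊗-cong; ⊗-assoc; ⊗-ᵀ; diag-⊗; ⊗-diag; diag-ᵀ; diag-central; matrixRing)

    ζₜ-self-dual : D.ζₜ ᵀ ≋ Q.ζₜ
    ζₜ-self-dual x y k with le x y in x≤y
    ... | false = refl
    ... | true  = ≡.cong (λ m → tpow m k) ([o∸m]∸[o∸n]≡n∸m (ρ-mono x≤y) (ρ-mono (top-max y)))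

    μₚ-self-dual : D.μₚ ᵀ ≋ Q.μₚ
    μₚ-self-dual x y k = ≡.cong (λ a → constₚ a k) (μ-self-dual x y)

    open Q using (tI; [t-1]I)

    ζₜ⊗μₚ-dual : ∀ x y → (Q.ζₜ ⊗ Q.μₚ) x y ≈ₚ (D.μₚ ⊗ D.ζₜ) y x
    ζₜ⊗μₚ-dual x y k = ≡.trans
      (⊗-cong {Q.ζₜ} (λ a b k → ≡.sym (ζₜ-self-dual a b k)) (λ a b k → ≡.sym (μₚ-self-dual a b k)) x y k)
      (≡.sym (⊗-ᵀ D.μₚ D.ζₜ x y k))

    dual-resolventᵀ : D.H̲ ᵀ ⊗ (tI ⊖ Q.ζₜ ⊗ Q.μₚ) ≋ [t-1]I
    dual-resolventᵀ = begin
      D.H̲ ᵀ ⊗ (tI ⊖ Q.ζₜ ⊗ Q.μₚ)       ≈⟨ ⊗-cong {D.H̲ ᵀ} (λ _ _ _ → refl) transposed ⟩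
      D.H̲ ᵀ ⊗ (tI ⊖ D.μₚ ⊗ D.ζₜ) ᵀ     ≈⟨ ⊗-ᵀ (tI ⊖ D.μₚ ⊗ D.ζₜ) D.H̲ ⟨
      ((tI ⊖ D.μₚ ⊗ D.ζₜ) ⊗ D.H̲) ᵀ     ≈⟨ (λ x y → D.resolvent y x) ⟩
      [t-1]I ᵀ                         ≈⟨ diag-ᵀ t-1 ⟩
      [t-1]I                           ∎
      where
      open import Relation.Binary.Reasoning.Setoid (Ring.setoid matrixRing)
      transposed : tI ⊖ Q.ζₜ ⊗ Q.μₚ ≋ (tI ⊖ D.μₚ ⊗ D.ζₜ) ᵀ
      transposed x y k = ≡.cong₂ (λ a b → a ℤ.+ - b) (≡.sym (diag-ᵀ (tpow 1) x y k)) (ζₜ⊗μₚ-dual x y k)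

    ζₜ⊗H̲≋H̲ᵈᵀ⊗ζₜ : Q.ζₜ ⊗ Q.H̲ ≋ D.H̲ ᵀ ⊗ Q.ζₜ
    ζₜ⊗H̲≋H̲ᵈᵀ⊗ζₜ x y = t-1*-cancel λ k → begin
      (t-1 *ₚ (Q.ζₜ ⊗ Q.H̲) x y) k          ≡⟨ diag-⊗ t-1 (Q.ζₜ ⊗ Q.H̲) x y k ⟨
      ([t-1]I ⊗ (Q.ζₜ ⊗ Q.H̲)) x y k        ≡⟨ ⊗-assoc [t-1]I Q.ζₜ Q.H̲ x y k ⟨
      (([t-1]I ⊗ Q.ζₜ) ⊗ Q.H̲) x y k        ≡⟨ intertwined x y k ⟨
      ((D.H̲ ᵀ ⊗ Q.ζₜ) ⊗ [t-1]I) x y k      ≡⟨ ⊗-diag t-1 (D.H̲ ᵀ ⊗ Q.ζₜ) x y k ⟩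
      ((D.H̲ ᵀ ⊗ Q.ζₜ) x y *ₚ t-1) k        ≡⟨ *ₚ-comm ((D.H̲ ᵀ ⊗ Q.ζₜ) x y) t-1 k ⟩
      (t-1 *ₚ (D.H̲ ᵀ ⊗ Q.ζₜ) x y) k        ∎
      where
      open ≡.≡-Reasoning
      open RingLemmas matrixRing using (push-through; intertwine)
      intertwined : (D.H̲ ᵀ ⊗ Q.ζₜ) ⊗ [t-1]I ≋ ([t-1]I ⊗ Q.ζₜ) ⊗ Q.H̲
      intertwined = intertwine (tI ⊖ Q.μₚ ⊗ Q.ζₜ) (tI ⊖ Q.ζₜ ⊗ Q.μₚ) Q.ζₜ Q.H̲ (D.H̲ ᵀ) [t-1]I
        (push-through tI Q.ζₜ Q.μₚ (diag-central (tpow 1) Q.ζₜ)) Q.resolvent dual-resolventᵀ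

    Gᵈ≈H̲ᵈᵀ⊗ζₜ : D.G ≈ₚ (D.H̲ ᵀ ⊗ Q.ζₜ) bot top
    Gᵈ≈H̲ᵈᵀ⊗ζₜ k = begin
      D.G k                          ≡⟨ D.G≈ζₜ⊗H̲ top-max (ℕ.n∸n≡0 (ρ top)) k ⟩
      (D.ζₜ ⊗ D.H̲) top bot k         ≡⟨ ⊗-ᵀ D.ζₜ D.H̲ bot top k ⟩
      (D.H̲ ᵀ ⊗ D.ζₜ ᵀ) bot top k     ≡⟨ ⊗-cong {D.H̲ ᵀ} (λ _ _ _ → refl) ζₜ-self-dual bot top k ⟩
      (D.H̲ ᵀ ⊗ Q.ζₜ) bot top k       ∎
      where open ≡.≡-Reasoning

corollary4p2 : (P : BoundedGradedPoset) → (k : ℕ) →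
    Chow.G (BoundedGradedPoset.raw P) k ≡ Chow.G (dual (BoundedGradedPoset.raw P)) k
corollary4p2 P k = begin
  Q.G k                        ≡⟨ Q.G≈ζₜ⊗H̲ bot-min ρ-bot k ⟩
  (Q.ζₜ ⊗ Q.H̲) bot top k       ≡⟨ ζₜ⊗H̲≋H̲ᵈᵀ⊗ζₜ bot top k ⟩
  (D.H̲ ᵀ ⊗ Q.ζₜ) bot top k     ≡⟨ Gᵈ≈H̲ᵈᵀ⊗ζₜ k ⟨
  D.G k                        ∎
  where
  open ≡-Reasoning
  open BoundedGradedPoset P using (bot; top)
  open IsBoundedGraded (BoundedGradedPoset.isBounded P) using (bot-min; ρ-bot)
  open SelfDuality.Duality P using (module Q; module D; ζₜ⊗H̲≋H̲ᵈᵀ⊗ζₜ; Gᵈ≈H̲ᵈᵀ⊗ζₜ)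
  open Q.PM using (_⊗_; _ᵀ)
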